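{- $\mathcal{L}(W)$ is less expressive than $\mathcal{L}(\Box)$ on the class of $\mathcal{S}5$-models. Consequently, $\mathcal{L}(W)$ is less expressive than $\mathcal{L}(\Box)$ on each of the classes of $\mathcal{K}$-models, $\mathcal{D}$-models, $\mathcal{T}$-models, $4$-models, $\mathcal{B}$-models, $5$-models, $\mathcal{D}4$-models and $\mathcal{D}45$-models.
   Context: Fix a nonempty set $\mathbf{P}$ of propositional variables. $\mathcal{L}(W)$: $\phi::=p\mid\neg\phi\mid(\phi\land\phi)\mid W\phi$; $\mathcal{L}(\Box)$: $\phi::=p\mid\neg\phi\mid(\phi\land\phi)\mid\Box\phi$ ($p\in\mathbf{P}$). A model is $(S,R,V)$ with $S\neq\emptyset$, $R\subseteq S\times S$, $V:\mathbf{P}\to2^S$. Truth: Boolean clauses as usual; $\mathcal{M},s\vDash\Box\phi$ iff $\phi$ holds at all $R$-successors of $s$; $\mathcal{M},s\vDash W\phi$ iff $\mathcal{M},s\nvDash\phi$ and $\phi$ holds at all $R$-successors of $s$. For a class $C$ of models, a language $L_1$ is at least as expressive as $L_2$ on $C$ if every formula of $L_2$ is equivalent (true at the same states of every model in $C$) to some formula of $L_1$; $L_1$ is less expressive than $L_2$ on $C$ if $L_2$ is at least as expressive as $L_1$ on $C$ but not conversely. Model classes by properties of $R$: $\mathcal{K}$ all; $\mathcal{D}$ serial; $\mathcal{T}$ reflexive; $4$ transitive; $\mathcal{B}$ symmetric; $5$ Euclidean; $\mathcal{D}4$ serial and transitive; $\mathcal{D}45$ serial, transitive and Euclidean; $\mathcal{S}5$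 equivalence relations. -}

module Defs where

open import Level using (Level; 0ℓ) renaming (suc to lsuc)
open import Data.Product using (Σ; ∃; _×_; _,_)
open import Data.Unit using (⊤)
open import Relation.Nullary using (¬_)

_⟺_ : Set → Set → Set
A ⟺ B = (A → B) × (B → A)

module _ (P : Set) where

  data FormW : Set where
    varW : P → FormW
    negW : FormW → FormW
    andW : FormW → FormW → FormW
    W    : FormW → FormW

  data FormB : Set where
    varB : P → FormB
    negB : FormB → FormB
    andB : FormB → FormB → FormB
    box  : FormB → FormB

  record Model : Set₁ where
    field
      S     : Set
      point : S                 -- witness that S ≠ ∅
      R     : S → S → Set
      V     : P → S → Set

  open Model public

  satW : (M : Model) → S M → FormW → Set
  satW M s (varW p)   = V M p s
  satW M s (negW φ)   = ¬ satW M s φ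
  satW M s (andW φ ψ) = satW M s φ × satW M s ψ
  satW M s (W φ)      = ¬ satW M s φ × (∀ t → R M s t → satW M t φ)

  satB : (M : Model) → S M → FormB → Set
  satB M s (varB p)   = V M p s
  satB M s (negB φ)   = ¬ satB M s φ
  satB M s (andB φ ψ) = satB M s φ × satB M s ψ
  satB M s (box φ)    = ∀ t → R M s t → satB M t φ

  ModelClass : Set₂
  ModelClass = Model → Set₁

  BoxAtLeastW : ModelClass → Set₁
  BoxAtLeastW C = (φ : FormW) → Σ FormB λ ψ →
    (M : Model) → C M → (s : S M) → satB M s ψ ⟺ satW M s φ

  WAtLeastBox : ModelClass → Set₁
  WAtLeastBox C = (φ : FormB) → Σ FormW λ ψ →
    (M : Model) → C M → (s : S M) → satW M s ψ ⟺ satB M s φ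

  WLessThanBox : ModelClass → Set₁
  WLessThanBox C = BoxAtLeastW C × ¬ WAtLeastBox C

  Serial Reflexive Transitive Symmetric Euclidean : Model → Set
  Serial     M = ∀ s → ∃ λ t → R M s t
  Reflexive  M = ∀ s → R M s s
  Transitive M = ∀ s t u → R M s t → R M t u → R M s u
  Symmetric  M = ∀ s t → R M s t → R M t s
  Euclidean  M = ∀ s t u → R M s t → R M s u → R M t u

  lift : Set → Set₁
  lift A = Level.Lift (lsuc 0ℓ) A

  Kclass Dclass Tclass 4class Bclass 5class D4class D45class S5class : ModelClass
  Kclass   M = lift ⊤
  Dclass   M = lift (Serial M)
  Tclass   M = lift (Reflexive M)
  4class   M = lift (Transitive M)
  Bclass   M = lift (Symmetric M)
  5class   M = lift (Euclidean M)
  D4class  M = lift (Serial M × Transitive M)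
  D45class M = lift (Serial M × Transitive M × Euclidean M)
  S5class  M = lift (Reflexive M × Symmetric M × Transitive M)

-- Every W-formula is a □-formula: Wφ is ¬φ ∧ □φ.  Conversely, on a reflexive
-- frame Wφ is never true (φ would have to fail at s and hold at the successor s),
-- so on reflexive models a W-formula only sees the valuation at the evaluation
-- point.  The one-point universal model and the two-point universal model with
-- every variable false at the second point agree on all variables at their
-- distinguished points, yet □p separates them.  Both are S5 models, hence lie in
-- each of the larger classes.
module Submission where

open import Defs
open import Data.Bool using (Bool; true; false; T)
open import Data.Empty using (⊥-elim)
open import Data.Product using (_×_; _,_; proj₁; proj₂) renaming (map to ×-map)
open import Data.Unit using (⊤; tt)
open import Function using (_∘_; id)
import Level
open import Relation.Nullary using (¬_)

⟺-refl : {A : Set} → A ⟺ A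
⟺-refl = id , id

⟺-¬ : {A B : Set} → A ⟺ B → (¬ A) ⟺ (¬ B)
⟺-¬ (to , from) = (_∘ from) , (_∘ to)

⟺-× : {A B C D : Set} → A ⟺ B → C ⟺ D → (A × C) ⟺ (B × D)
⟺-× (to₁ , from₁) (to₂ , from₂) = ×-map to₁ to₂ , ×-map from₁ from₂

⟺-guarded : {I : Set} {A B : I → Set} (G : I → Set) →
            (∀ i → A i ⟺ B i) → (∀ i → G i → A i) ⟺ (∀ i → G i → B i)
⟺-guarded G A⟺B = (λ h i g → proj₁ (A⟺B i) (h i g)) , (λ h i g → proj₂ (A⟺B i) (h i g))

module _ {P : Set} where

  W⇒□ : FormW P → FormB P
  W⇒□ (varW p)   = varB p
  W⇒□ (negW φ)   = negB (W⇒□ φ)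
  W⇒□ (andW φ ψ) = andB (W⇒□ φ) (W⇒□ ψ)
  W⇒□ (W φ)      = andB (negB (W⇒□ φ)) (box (W⇒□ φ))

  satB-W⇒□ : (M : Model P) (s : S M) (φ : FormW P) → satB P M s (W⇒□ φ) ⟺ satW P M s φ
  satB-W⇒□ M s (varW p)   = ⟺-refl
  satB-W⇒□ M s (negW φ)   = ⟺-¬ (satB-W⇒□ M s φ)
  satB-W⇒□ M s (andW φ ψ) = ⟺-× (satB-W⇒□ M s φ) (satB-W⇒□ M s ψ)
  satB-W⇒□ M s (W φ)      =
    ⟺-× (⟺-¬ (satB-W⇒□ M s φ)) (⟺-guarded (R M s) λ t → satB-W⇒□ M t φ)

  □-atLeast-W : (C : ModelClass P) → BoxAtLeastW P C
  □-atLeast-W C φ = W⇒□ φ , λ M _ s → satB-W⇒□ M s φ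

  W-false-on-reflexive : (M : Model P) → Reflexive P M → (s : S M) (φ : FormW P) → ¬ satW P M s (W φ)
  W-false-on-reflexive M refl s φ (¬φ , □φ) = ¬φ (□φ s (refl s))

  satW-local : (M N : Model P) → Reflexive P M → Reflexive P N → (s : S M) (t : S N) →
               (∀ p → V M p s ⟺ V N p t) → (φ : FormW P) → satW P M s φ ⟺ satW P N t φ
  satW-local M N reflM reflN s t V⟺ (varW p)   = V⟺ p
  satW-local M N reflM reflN s t V⟺ (negW φ)   = ⟺-¬ (satW-local M N reflM reflN s t V⟺ φ)
  satW-local M N reflM reflN s t V⟺ (andW φ ψ) =
    ⟺-× (satW-local M N reflM reflN s t V⟺ φ) (satW-local M N reflM reflN s t V⟺ ψ)
  satW-local M N reflM reflN s t V⟺ (W φ)      =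
    ⊥-elim ∘ W-false-on-reflexive M reflM s φ , ⊥-elim ∘ W-false-on-reflexive N reflN t φ

  universal : (S : Set) → S → (P → S → Set) → Model P
  universal S s V = record { S = S ; point = s ; R = λ _ _ → ⊤ ; V = V }

  universal-S5 : (S : Set) (s : S) (V : P → S → Set) → S5class P (universal S s V)
  universal-S5 S s V = Level.lift ((λ _ → tt) , (λ _ _ _ → tt) , (λ _ _ _ _ _ → tt))

  onePoint : Model P
  onePoint = universal ⊤ tt (λ _ _ → ⊤)

  twoPoint : Model P
  twoPoint = universal Bool true (λ _ → T)

  □-not-W-expressible-on-S5 : P → ¬ WAtLeastBox P (S5class P)
  □-not-W-expressible-on-S5 p W-expresses with W-expresses (box (varB p))
  ... | ψ , ψ⟺□p = □p-false-at-two (proj₁ (ψ⟺□p twoPoint S5-two true) ψ-at-two)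
    where
    S5-one : S5class P onePoint
    S5-one = universal-S5 ⊤ tt (λ _ _ → ⊤)
    S5-two : S5class P twoPoint
    S5-two = universal-S5 Bool true (λ _ → T)
    ψ-at-one : satW P onePoint tt ψ
    ψ-at-one = proj₂ (ψ⟺□p onePoint S5-one tt) (λ _ _ → tt)
    ψ-at-two : satW P twoPoint true ψ
    ψ-at-two = proj₁ (satW-local onePoint twoPoint (λ _ → tt) (λ _ → tt) tt true
                        (λ _ → (λ _ → tt) , (λ _ → tt)) ψ) ψ-at-one
    □p-false-at-two : ¬ satB P twoPoint true (box (varB p))
    □p-false-at-two □p = □p false tt

  WAtLeastBox-antitone : {C D : ModelClass P} → (∀ M → C M → D M) → WAtLeastBox P D → WAtLeastBox P C
  WAtLeastBox-antitone C⊆D W-expresses φ with W-expresses φ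
  ... | ψ , ψ⟺φ = ψ , λ M M∈C → ψ⟺φ M (C⊆D M M∈C)

  W-less-than-□-above-S5 : P → (C : ModelClass P) → (∀ M → S5class P M → C M) → WLessThanBox P C
  W-less-than-□-above-S5 p C S5⊆C =
    □-atLeast-W C , □-not-W-expressible-on-S5 p ∘ WAtLeastBox-antitone S5⊆C

  reflexive⇒serial : (M : Model P) → Reflexive P M → Serial P M
  reflexive⇒serial M refl s = s , refl s

  symmetric∧transitive⇒euclidean : (M : Model P) → Symmetric P M → Transitive P M → Euclidean P M
  symmetric∧transitive⇒euclidean M sym trans s t u sRt sRu = trans t s u (sym s t sRt) sRu

  W-less-than-□-on-frames :
    {F : Model P → Set} → P →
    (∀ M → Reflexive P M → Symmetric P M → Transitive P M → F M) →
    WLessThanBox P (λ M → lift P (F M))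
  W-less-than-□-on-frames p S5⇒F =
    W-less-than-□-above-S5 p _
      λ { M (Level.lift (refl , sym , trans)) → Level.lift (S5⇒F M refl sym trans) }

mainTheorem14 : (P : Set) → P →
    WLessThanBox P (S5class P)
      × WLessThanBox P (Kclass P)
      × WLessThanBox P (Dclass P)
      × WLessThanBox P (Tclass P)
      × WLessThanBox P (4class P)
      × WLessThanBox P (Bclass P)
      × WLessThanBox P (5class P)
      × WLessThanBox P (D4class P)
      × WLessThanBox P (D45class P)
mainTheorem14 P p =
    on-frames (λ M refl sym trans → refl , sym , trans)
  , on-frames (λ M _ _ _ → tt)
  , on-frames (λ M refl _ _ → reflexive⇒serial M refl)
  , on-frames (λ M refl _ _ → refl)
  , on-frames (λ M _ _ trans → trans)
  , on-frames (λ M _ sym _ → sym)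
  , on-frames (λ M _ sym trans → symmetric∧transitive⇒euclidean M sym trans)
  , on-frames (λ M refl _ trans → reflexive⇒serial M refl , trans)
  , on-frames (λ M refl sym trans →
      reflexive⇒serial M refl , trans , symmetric∧transitive⇒euclidean M sym trans)
  where
  on-frames : {F : Model P → Set} →
              (∀ M → Reflexive P M → Symmetric P M → Transitive P M → F M) →
              WLessThanBox P (λ M → lift P (F M))
  on-frames = W-less-than-□-on-frames p
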